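{- If $m=3b+2$ and $n=3c+2$ for some positive integers $b$ and $c$, then $va^\equiv_1(K_{m,n})=b+c+2$.
   Context: All graphs are finite and simple. For a graph $G$ with $N=|V(G)|$ vertices, an equitable $(q,r)$-tree-coloring of $G$ is a partition of $V(G)$ into $q$ sets, each of size $\lfloor N/q\rfloor$ or $\lceil N/q\rceil$, such that each set induces a forest of maximum degree at most $r$. The strong equitable vertex $r$-arboricity $va^\equiv_r(G)$ is the minimum $p$ such that $G$ has an equitable $(q,r)$-tree-coloring for every integer $q\ge p$. $K_{m,n}$ is the complete bipartite graph with parts of sizes $m$ and $n$. -}

module Defs where

open import Data.Nat using (ℕ; zero; suc; _+_; _∸_; _≤_; _<_; _≥_)
open import Data.Nat.DivMod using (_/_)
open import Data.Fin using (Fin; toℕ)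
open import Data.Fin.Properties using (_≟_)
open import Data.Bool using (Bool; true; false; _∧_; T)
open import Data.List using (List; []; _∷_; _++_; length; filterᵇ; allFin)
open import Data.List.Relation.Unary.All using (All)
open import Data.List.Relation.Unary.Unique.Propositional using (Unique)
open import Data.Product using (Σ; _×_; _,_)
open import Data.Sum using (_⊎_)
open import Data.Unit using (⊤)
open import Data.Empty using (⊥)
open import Relation.Nullary using (¬_; Dec; yes; no)
open import Relation.Nullary.Decidable using (⌊_⌋)
open import Relation.Binary.PropositionalEquality using (_≡_)

record Graph : Set where
  field
    N      : ℕ
    adj    : Fin N → Fin N → Bool
    sym    : ∀ u v → adj u v ≡ adj v u
    irrefl : ∀ v → adj v v ≡ false
open Graph public

-- Complete bipartite graph K_{m,n}: vertices 0..m-1 form one part,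
-- vertices m..m+n-1 the other; u ~ v iff they lie in different parts.
side : ∀ {k} → ℕ → Fin k → Bool
side m v = ⌊ toℕ v Data.Nat.<? m ⌋

xor : Bool → Bool → Bool
xor true  b = Data.Bool.not b
xor false b = b

K : ℕ → ℕ → Graph
K m n = record
  { N = m + n
  ; adj = λ u v → xor (side m u) (side m v)
  ; sym = λ u v → xorSym (side m u) (side m v)
  ; irrefl = λ v → xorSelf (side m v)
  }
  where
    xorSym : ∀ a b → xor a b ≡ xor b a
    xorSym true true = _≡_.refl
    xorSym true false = _≡_.refl
    xorSym false true = _≡_.refl
    xorSym false false = _≡_.refl
    xorSelf : ∀ a → xor a a ≡ false
    xorSelf true = _≡_.refl
    xorSelf false = _≡_.refl

module _ (G : Graph) where
  V : Set
  V = Fin (N G)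

  Walk : (V → Set) → List V → Set
  Walk S []           = ⊤
  Walk S (x ∷ [])     = S x
  Walk S (x ∷ y ∷ vs) = S x × T (adj G x y) × Walk S (y ∷ vs)

  CycleIn : (V → Set) → Set
  CycleIn S = Σ V λ x → Σ (List V) λ xs →
    (3 ≤ length (x ∷ xs)) × Unique (x ∷ xs) × Walk S (x ∷ xs ++ x ∷ [])

  module _ {q : ℕ} (c : V → Fin q) where
    classSize : Fin q → ℕ
    classSize i = length (filterᵇ (λ u → ⌊ c u ≟ i ⌋) (allFin (N G)))

    classDeg : V → ℕ
    classDeg v = length (filterᵇ (λ u → adj G v u ∧ ⌊ c u ≟ c v ⌋) (allFin (N G)))

    ClassForest : Fin q → Set
    ClassForest i = ¬ CycleIn (λ v → c v ≡ i)

⌈_/suc_⌉ : ℕ → ℕ → ℕ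
⌈ a /suc k ⌉ = (a + k) / suc k

-- s is ⌊a/q⌋ or ⌈a/q⌉ (q ≥ 1); for q = 0 there are no classes, so this is never used
EqSize : ℕ → ℕ → ℕ → Set
EqSize a zero    s = ⊥
EqSize a (suc k) s = (s ≡ a / suc k) ⊎ (s ≡ ⌈ a /suc k ⌉)

EquitableTreeColoring : (G : Graph) (q r : ℕ) → Set
EquitableTreeColoring G q r = Σ (V G → Fin q) λ c →
    (∀ i → EqSize (N G) q (classSize G c i))
  × (∀ i → ClassForest G c i)
  × (∀ v → classDeg G c v ≤ r)

StronglyColorableFrom : Graph → ℕ → ℕ → Set
StronglyColorableFrom G r p = ∀ q → q ≥ p → EquitableTreeColoring G q r

IsStrongEqVertexArboricity : Graph → ℕ → ℕ → Set
IsStrongEqVertexArboricity G r p =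
  StronglyColorableFrom G r p × (∀ p' → StronglyColorableFrom G r p' → p ≤ p')

-- A colour class of K_{m,n} inducing a forest of maximum degree 1 lies inside one side or is
-- a single edge.  For q ≥ b + c + 2 colours the equitable class sizes are at most 3: list the
-- vertices as the side A followed by the side B and colour consecutive blocks of the required
-- sizes, ordered so that the block straddling the cut between A and B has at most two vertices
-- (blocks of 3, then the blocks of 2 around the cut, then blocks of 3).  For q = b + c + 1
-- colours the sizes are 3 and 4, with exactly one 4, so every class lies inside one side, and
-- m = 3b + 2 would be a sum of 3's and at most one 4, which is impossible modulo 3.

module Submission where

open import Defs hiding (sym)
open import Data.Bool using (Bool; true; false; T; if_then_else_; _∧_)
open import Data.Bool.Properties using (T-≡; T-∧)
open import Data.Empty using (⊥-elim)
open import Data.Fin using (Fin; zero; suc; toℕ; _↑ˡ_; _↑ʳ_; splitAt; cast)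
open import Data.Fin.Properties
  using (_≟_; 0≢1+n; any?; cast-is-id; toℕ-cast; toℕ-injective; toℕ<n; toℕ-↑ˡ; toℕ-↑ʳ; splitAt-↑ˡ; splitAt-↑ʳ)
import Data.Fin.Properties as Fin
open import Data.List using (List; []; _∷_; _++_; length; lookup; replicate; filterᵇ; tabulate)
open import Data.List.Properties using (length-++; length-replicate)
open import Data.List.Membership.Propositional.Properties using (∈-lookup)
open import Data.List.Relation.Unary.All using (All; []; _∷_)
import Data.List.Relation.Unary.All as All
open import Data.List.Relation.Unary.All.Properties using (++⁺; replicate⁺)
open import Data.List.Relation.Unary.AllPairs using (_∷_)
open import Data.Nat using (ℕ; zero; suc; _+_; _*_; _∸_; _≤_; _<_; z≤n; s≤s; s≤s⁻¹; _≤?_; _<?_)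
open import Data.Nat.DivMod
  using (_/_; _%_; m≡m%n+[m/n]*n; m%n<n; m/n*n≤m; m*n/n≡m; /-monoˡ-≤; m<n*o⇒m/o<n; [m+kn]%n≡m%n; m<n⇒m%n≡m)
open import Data.Nat.ListAction using (sum)
open import Data.Nat.ListAction.Properties using (sum-++)
open import Data.Nat.Properties hiding (_≟_; 0≢1+n)
open import Data.Nat.Tactic.RingSolver using (solve-∀)
open import Algebra.Properties.Semiring.Sum +-*-semiring
  using (sum-syntax; sum-cong-≗; ∑-comm; ∑-distrib-+; *-distribʳ-sum)
open import Data.Product using (∃; _×_; _,_; proj₂)
import Data.Sum as Sum
open import Data.Sum using (_⊎_; inj₁; inj₂; [_,_]′)
open import Data.Unit using (⊤; tt)
open import Function using (_∘_; id; Equivalence)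
open import Relation.Nullary using (¬_; yes; no)
open import Relation.Nullary.Decidable using (⌊_⌋; T?; toWitness; fromWitness)
open import Relation.Binary.PropositionalEquality
  using (_≡_; refl; sym; trans; cong; cong₂; subst; subst₂; module ≡-Reasoning)

count : ∀ {n} → (Fin n → Bool) → ℕ
count {n} p = ∑[ i < n ] (if p i then 1 else 0)

length-filterᵇ-tabulate : ∀ {A : Set} n (f : Fin n → A) (p : A → Bool) →
  length (filterᵇ p (tabulate f)) ≡ count (p ∘ f)
length-filterᵇ-tabulate zero    f p = refl
length-filterᵇ-tabulate (suc n) f p with p (f zero)
... | true  = cong suc (length-filterᵇ-tabulate n (f ∘ suc) p)
... | false = length-filterᵇ-tabulate n (f ∘ suc) p

sum-↑ : ∀ m {n} (f : Fin (m + n) → ℕ) →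
  ∑[ i < m + n ] f i ≡ ∑[ i < m ] f (i ↑ˡ n) + ∑[ j < n ] f (m ↑ʳ j)
sum-↑ zero    f = refl
sum-↑ (suc m) f = trans (cong (f zero +_) (sum-↑ m (f ∘ suc))) (sym (+-assoc (f zero) _ _))

sum-mono-≤ : ∀ {n} {f g : Fin n → ℕ} → (∀ i → f i ≤ g i) → ∑[ i < n ] f i ≤ ∑[ i < n ] g i
sum-mono-≤ {zero}  f≤g = z≤n
sum-mono-≤ {suc n} f≤g = +-mono-≤ (f≤g zero) (sum-mono-≤ (f≤g ∘ suc))

sum-const : ∀ n x → ∑[ i < n ] x ≡ n * x
sum-const zero    x = refl
sum-const (suc n) x = cong (x +_) (sum-const n x)

count-cong : ∀ {n} {p r : Fin n → Bool} → (∀ i → p i ≡ r i) → count p ≡ count r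
count-cong p≗r = sum-cong-≗ (λ i → cong (if_then 1 else 0) (p≗r i))

count-all : ∀ n → count {n} (λ _ → true) ≡ n
count-all n = trans (sum-const n 1) (*-identityʳ n)

count-false : ∀ n → count {n} (λ _ → false) ≡ 0
count-false n = trans (sum-const n 0) (*-zeroʳ n)

count-none : ∀ {n} (p : Fin n → Bool) → (∀ i → ¬ T (p i)) → count p ≡ 0
count-none {zero}  p none = refl
count-none {suc n} p none with p zero | none zero
... | true  | ¬t = ⊥-elim (¬t tt)
... | false | _  = count-none (p ∘ suc) (none ∘ suc)

count-≤1 : ∀ {n} (p : Fin n → Bool) → (∀ u w → T (p u) → T (p w) → u ≡ w) → count p ≤ 1
count-≤1 {zero}  p unique = z≤n
count-≤1 {suc n} p unique with p zero in p₀
... | true  = ≤-reflexive (cong suc (count-none (p ∘ suc) (λ i t →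
                0≢1+n (unique zero (suc i) (subst T (sym p₀) tt) t))))
... | false = count-≤1 (p ∘ suc) (λ u w pu pw → Fin.suc-injective (unique (suc u) (suc w) pu pw))

count-witness : ∀ {n} (p : Fin n → Bool) → 1 ≤ count p → ∃ λ u → T (p u)
count-witness p positive with any? (λ u → T? (p u))
... | yes witness = witness
... | no  none    = ⊥-elim (<⇒≱ positive (≤-reflexive (count-none p (λ u t → none (u , t)))))

count-cast : ∀ {M N} (e : M ≡ N) (p : Fin N → Bool) → count (p ∘ cast e) ≡ count p
count-cast refl p = count-cong (λ i → cong p (cast-is-id refl i))

⌊suc≟suc⌋ : ∀ {n} (a b : Fin n) → ⌊ suc a ≟ suc b ⌋ ≡ ⌊ a ≟ b ⌋
⌊suc≟suc⌋ a b with a ≟ b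
... | yes _ = refl
... | no  _ = refl

count-≟ : ∀ {q} (j : Fin q) → count (λ i → ⌊ j ≟ i ⌋) ≡ 1
count-≟ {suc q} zero = cong suc (count-false q)
count-≟ (suc j) = trans (count-cong (⌊suc≟suc⌋ j)) (count-≟ j)

sum-count-fibres : ∀ {M q} (h : Fin M → Fin q) → ∑[ i < q ] count (λ u → ⌊ h u ≟ i ⌋) ≡ M
sum-count-fibres {M} {q} h = begin
  ∑[ i < q ] ∑[ u < M ] (if ⌊ h u ≟ i ⌋ then 1 else 0) ≡⟨ ∑-comm (λ i u → if ⌊ h u ≟ i ⌋ then 1 else 0) ⟩
  ∑[ u < M ] count (λ i → ⌊ h u ≟ i ⌋)               ≡⟨ sum-cong-≗ (count-≟ ∘ h) ⟩
  count {M} (λ _ → true)                               ≡⟨ count-all M ⟩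
  M                                                    ∎
  where open ≡-Reasoning

-- Colourings whose classes induce matchings

InducesMatchings : (G : Graph) {q : ℕ} → (V G → Fin q) → Set
InducesMatchings G c =
  ∀ u v w → T (adj G u v) → T (adj G v w) → c u ≡ c v → c v ≡ c w → u ≡ w

inducesMatchings⇒classDeg≤1 : (G : Graph) {q : ℕ} (c : V G → Fin q) →
  InducesMatchings G c → ∀ v → classDeg G c v ≤ 1
inducesMatchings⇒classDeg≤1 G c matching v =
  subst (_≤ 1) (sym (length-filterᵇ-tabulate (N G) id _)) (count-≤1 _ neighbours-equal)
  where
  neighbours-equal : ∀ u w → T (adj G v u ∧ ⌊ c u ≟ c v ⌋) → T (adj G v w ∧ ⌊ c w ≟ c v ⌋) → u ≡ w
  neighbours-equal u w pu pw with Equivalence.to T-∧ pu | Equivalence.to T-∧ pw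
  ... | v~u , cu | v~w , cw = matching u v w (subst T (Graph.sym G v u) v~u) v~w
                                (toWitness cu) (sym (toWitness cw))

walk-head : (G : Graph) {S : V G → Set} (y : V G) (ys : List (V G)) → Walk G S (y ∷ ys) → S y
walk-head G y []      Sy       = Sy
walk-head G y (_ ∷ _) (Sy , _) = Sy

inducesMatchings⇒classForest : (G : Graph) {q : ℕ} (c : V G → Fin q) →
  InducesMatchings G c → ∀ i → ClassForest G c i
inducesMatchings⇒classForest G c matching i (x , [] , s≤s () , _)
inducesMatchings⇒classForest G c matching i (x , _ ∷ [] , s≤s (s≤s ()) , _)
inducesMatchings⇒classForest G c matching i
  (x , x₁ ∷ x₂ ∷ xs , _ , (_ ∷ x≢x₂ ∷ _) ∷ _ , (cx , x~x₁ , cx₁ , x₁~x₂ , walk)) =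
  x≢x₂ (matching x x₁ x₂ x~x₁ x₁~x₂ (trans cx (sym cx₁))
         (trans cx₁ (sym (walk-head G x₂ (xs ++ x ∷ []) walk))))

adj-K⇒across : ∀ m n (u v : Fin (m + n)) → T (adj (K m n) u v) →
  (toℕ u < m × m ≤ toℕ v) ⊎ (toℕ v < m × m ≤ toℕ u)
adj-K⇒across m n u v u~v with toℕ u <? m | toℕ v <? m
... | yes u<m | no  v≮m = inj₁ (u<m , ≮⇒≥ v≮m)
... | no  u≮m | yes v<m = inj₂ (v<m , ≮⇒≥ u≮m)

MonochromaticOnlyAtCut : (m n : ℕ) {q : ℕ} → (Fin (m + n) → Fin q) → Set
MonochromaticOnlyAtCut m n c =
  ∀ u v → toℕ u < m → m ≤ toℕ v → c u ≡ c v → suc (toℕ u) ≡ m × toℕ v ≡ m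

monochromaticOnlyAtCut⇒inducesMatchings : ∀ m n {q} (c : Fin (m + n) → Fin q) →
  MonochromaticOnlyAtCut m n c → InducesMatchings (K m n) c
monochromaticOnlyAtCut⇒inducesMatchings m n c cut u v w u~v v~w cu≡cv cv≡cw
  with adj-K⇒across m n u v u~v | adj-K⇒across m n v w v~w
... | inj₁ (u<m , m≤v) | inj₂ (w<m , _) with cut u v u<m m≤v cu≡cv | cut w v w<m m≤v (sym cv≡cw)
...   | u+1≡m , _ | w+1≡m , _ = toℕ-injective (suc-injective (trans u+1≡m (sym w+1≡m)))
monochromaticOnlyAtCut⇒inducesMatchings m n c cut u v w u~v v~w cu≡cv cv≡cw
    | inj₂ (v<m , m≤u) | inj₁ (_ , m≤w) with cut v u v<m m≤u (sym cu≡cv) | cut v w v<m m≤w cv≡cw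
...   | _ , u≡m | _ , w≡m = toℕ-injective (trans u≡m (sym w≡m))
monochromaticOnlyAtCut⇒inducesMatchings m n c cut u v w u~v v~w cu≡cv cv≡cw
    | inj₁ (_ , m≤v) | inj₁ (v<m , _) = ⊥-elim (<⇒≱ v<m m≤v)
monochromaticOnlyAtCut⇒inducesMatchings m n c cut u v w u~v v~w cu≡cv cv≡cw
    | inj₂ (v<m , _) | inj₂ (_ , m≤v) = ⊥-elim (<⇒≱ v<m m≤v)

side-↑ˡ : ∀ m n (a : Fin m) → side m (a ↑ˡ n) ≡ true
side-↑ˡ m n a = Equivalence.to T-≡ (fromWitness (subst (_< m) (sym (toℕ-↑ˡ a n)) (toℕ<n a)))

side-↑ʳ : ∀ m n (b : Fin n) → side m (m ↑ʳ b) ≡ false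
side-↑ʳ m n b with toℕ (m ↑ʳ b) <? m
... | yes lt = ⊥-elim (<⇒≱ lt (subst (m ≤_) (sym (toℕ-↑ʳ m b)) (m≤m+n m (toℕ b))))
... | no  _  = refl

adj-↑ˡ-↑ʳ : ∀ m n (a : Fin m) (b : Fin n) → adj (K m n) (a ↑ˡ n) (m ↑ʳ b) ≡ true
adj-↑ˡ-↑ʳ m n a b = cong₂ xor (side-↑ˡ m n a) (side-↑ʳ m n b)

adj-↑ʳ-↑ˡ : ∀ m n (a : Fin m) (b : Fin n) → adj (K m n) (m ↑ʳ b) (a ↑ˡ n) ≡ true
adj-↑ʳ-↑ˡ m n a b = cong₂ xor (side-↑ʳ m n b) (side-↑ˡ m n a)

classDeg-↑ˡ : ∀ m n {q} (c : Fin (m + n) → Fin q) (a : Fin m) →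
  count (λ b → ⌊ c (m ↑ʳ b) ≟ c (a ↑ˡ n) ⌋) ≤ classDeg (K m n) c (a ↑ˡ n)
classDeg-↑ˡ m n c a = begin
  count (λ b → ⌊ c (m ↑ʳ b) ≟ c v ⌋)
    ≡⟨ count-cong (λ b → cong (_∧ ⌊ c (m ↑ʳ b) ≟ c v ⌋) (adj-↑ˡ-↑ʳ m n a b)) ⟨
  count (λ b → colleague (m ↑ʳ b))
    ≤⟨ m≤n+m _ _ ⟩
  count (λ a′ → colleague (a′ ↑ˡ n)) + count (λ b → colleague (m ↑ʳ b))
    ≡⟨ trans (length-filterᵇ-tabulate (m + n) id colleague) (sum-↑ m _) ⟨
  classDeg (K m n) c v ∎
  where
  open ≤-Reasoning
  v : Fin (m + n)
  v = a ↑ˡ n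
  colleague : Fin (m + n) → Bool
  colleague u = adj (K m n) v u ∧ ⌊ c u ≟ c v ⌋

classDeg-↑ʳ : ∀ m n {q} (c : Fin (m + n) → Fin q) (b : Fin n) →
  count (λ a → ⌊ c (a ↑ˡ n) ≟ c (m ↑ʳ b) ⌋) ≤ classDeg (K m n) c (m ↑ʳ b)
classDeg-↑ʳ m n c b = begin
  count (λ a → ⌊ c (a ↑ˡ n) ≟ c v ⌋)
    ≡⟨ count-cong (λ a → cong (_∧ ⌊ c (a ↑ˡ n) ≟ c v ⌋) (adj-↑ʳ-↑ˡ m n a b)) ⟨
  count (λ a → colleague (a ↑ˡ n))
    ≤⟨ m≤m+n _ _ ⟩
  count (λ a → colleague (a ↑ˡ n)) + count (λ b′ → colleague (m ↑ʳ b′))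
    ≡⟨ trans (length-filterᵇ-tabulate (m + n) id colleague) (sum-↑ m _) ⟨
  classDeg (K m n) c v ∎
  where
  open ≤-Reasoning
  v : Fin (m + n)
  v = m ↑ʳ b
  colleague : Fin (m + n) → Bool
  colleague u = adj (K m n) v u ∧ ⌊ c u ≟ c v ⌋

classSize-K : ∀ m n {q} (c : Fin (m + n) → Fin q) (i : Fin q) →
  classSize (K m n) c i ≡ count (λ a → ⌊ c (a ↑ˡ n) ≟ i ⌋) + count (λ b → ⌊ c (m ↑ʳ b) ≟ i ⌋)
classSize-K m n c i = trans (length-filterᵇ-tabulate (m + n) id _) (sum-↑ m _)

classDeg≤1⇒one-sidedˡ : ∀ m n {q} (c : Fin (m + n) → Fin q) → (∀ v → classDeg (K m n) c v ≤ 1) →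
  ∀ i → 1 ≤ count (λ a → ⌊ c (a ↑ˡ n) ≟ i ⌋) → count (λ b → ⌊ c (m ↑ʳ b) ≟ i ⌋) ≤ 1
classDeg≤1⇒one-sidedˡ m n c degree i meetsA with count-witness _ meetsA
... | a , ca≡i = subst (λ j → count (λ b → ⌊ c (m ↑ʳ b) ≟ j ⌋) ≤ 1) (toWitness ca≡i)
                   (≤-trans (classDeg-↑ˡ m n c a) (degree (a ↑ˡ n)))

classDeg≤1⇒one-sidedʳ : ∀ m n {q} (c : Fin (m + n) → Fin q) → (∀ v → classDeg (K m n) c v ≤ 1) →
  ∀ i → 1 ≤ count (λ b → ⌊ c (m ↑ʳ b) ≟ i ⌋) → count (λ a → ⌊ c (a ↑ˡ n) ≟ i ⌋) ≤ 1
classDeg≤1⇒one-sidedʳ m n c degree i meetsB with count-witness _ meetsB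
... | b , cb≡i = subst (λ j → count (λ a → ⌊ c (a ↑ˡ n) ≟ j ⌋) ≤ 1) (toWitness cb≡i)
                   (≤-trans (classDeg-↑ʳ m n c b) (degree (m ↑ʳ b)))

/-unique : ∀ {a e} k → e * suc k ≤ a → a < suc e * suc k → a / suc k ≡ e
/-unique {a} {e} k lo hi = ≤-antisym (s≤s⁻¹ (m<n*o⇒m/o<n hi))
  (subst (_≤ a / suc k) (m*n/n≡m e (suc k)) (/-monoˡ-≤ (suc k) lo))

-- e is ⌊N/(k+1)⌋ or ⌈N/(k+1)⌉, i.e. (e - 1)(k + 1) < N < (e + 1)(k + 1).
Admissible : ℕ → ℕ → ℕ → Set
Admissible N k e = e * suc k ≤ N + k × N < suc e * suc k

admissible⇒eqSize : ∀ N k e → Admissible N k e → EqSize N (suc k) e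
admissible⇒eqSize N k e (lo , hi) with e * suc k ≤? N
... | yes floor = inj₁ (sym (/-unique k floor hi))
... | no  ¬floor = inj₂ (sym (/-unique k lo (begin-strict
    N + k             <⟨ +-monoˡ-< k (≰⇒> ¬floor) ⟩
    e * suc k + k     ≤⟨ +-monoʳ-≤ (e * suc k) (n≤1+n k) ⟩
    e * suc k + suc k ≡⟨ +-comm (e * suc k) (suc k) ⟩
    suc e * suc k     ∎)))
  where open ≤-Reasoning

eqSize-3q+1 : ∀ {N k s} → 1 ≤ k → N ≡ 3 * suc k + 1 → EqSize N (suc k) s → s ≡ 3 ⊎ s ≡ 4
eqSize-3q+1 {N} {k} 1≤k N≡ = Sum.map (λ s≡ → trans s≡ floor) (λ s≡ → trans s≡ ceiling)
  where
  q : ℕ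
  q = suc k

  floor : N / q ≡ 3
  floor = /-unique k (≤-trans (m≤m+n (3 * q) 1) (≤-reflexive (sym N≡)))
    (subst (_< 4 * q) (sym N≡) (subst (3 * q + 1 <_) (+-comm (3 * q) q) (+-monoʳ-< (3 * q) (s≤s 1≤k))))

  four : 4 * q ≡ N + k
  four = trans (regroup k) (cong (_+ k) (sym N≡))
    where
    regroup : ∀ k → 4 * suc k ≡ 3 * suc k + 1 + k
    regroup = solve-∀

  ceiling : (N + k) / q ≡ 4
  ceiling = /-unique k (≤-reflexive four) (subst (_< 5 * q) four (m<n+m (4 * q) (s≤s z≤n)))

sum-replicate : ∀ n x → sum (replicate n x) ≡ x * n
sum-replicate zero    x = sym (*-zeroʳ x)
sum-replicate (suc n) x = trans (cong (x +_) (sum-replicate n x)) (sym (*-suc x n))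

replicate⁺-nonempty : ∀ {P : ℕ → Set} n {x} → (1 ≤ n → P x) → All P (replicate n x)
replicate⁺-nonempty zero    px = []
replicate⁺-nonempty (suc n) px = replicate⁺ (suc n) (px (s≤s z≤n))

balancedBlocks : ∀ N k → ∃ λ L → length L ≡ suc k × sum L ≡ N × All (Admissible N k) L
balancedBlocks N k with m≤n⇒∃[o]m+o≡n (<⇒≤ (m%n<n N (suc k)))
... | d , r+d≡q =
  replicate r (suc s) ++ replicate d s , length≡ , sum≡ ,
  ++⁺ (replicate⁺-nonempty r ceiling) (replicate⁺ d floor)
  where
  q s r : ℕ
  q = suc k
  s = N / q
  r = N % q

  N≡ : N ≡ r + s * q
  N≡ = m≡m%n+[m/n]*n N q

  length≡ : length (replicate r (suc s) ++ replicate d s) ≡ q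
  length≡ = trans (length-++ (replicate r (suc s)))
                  (trans (cong₂ _+_ (length-replicate r) (length-replicate d)) r+d≡q)

  sum≡ : sum (replicate r (suc s) ++ replicate d s) ≡ N
  sum≡ = begin
    sum (replicate r (suc s) ++ replicate d s)       ≡⟨ sum-++ (replicate r (suc s)) _ ⟩
    sum (replicate r (suc s)) + sum (replicate d s) ≡⟨ cong₂ _+_ (sum-replicate r (suc s)) (sum-replicate d s) ⟩
    suc s * r + s * d                                ≡⟨ regroup r d s ⟩
    r + s * (r + d)                                  ≡⟨ cong (λ x → r + s * x) r+d≡q ⟩
    r + s * q                                        ≡⟨ sym N≡ ⟩
    N                                                ∎
    where
    open ≡-Reasoning
    regroup : ∀ r d s → suc s * r + s * d ≡ r + s * (r + d)
    regroup = solve-∀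

  floor : Admissible N k s
  floor = ≤-trans (m/n*n≤m N q) (m≤m+n N k) ,
          subst (_< q + s * q) (sym N≡) (+-monoˡ-< (s * q) (m%n<n N q))

  ceiling : 1 ≤ r → Admissible N k (suc s)
  ceiling 1≤r = (begin
      q + s * q     ≤⟨ +-monoˡ-≤ (s * q) (+-monoˡ-≤ k 1≤r) ⟩
      r + k + s * q ≡⟨ swap r k (s * q) ⟩
      r + s * q + k ≡⟨ cong (_+ k) N≡ ⟨
      N + k         ∎) ,
    <-≤-trans (proj₂ floor) (m≤n+m (suc s * q) q)
    where
    open ≤-Reasoning
    swap : ∀ a b c → a + b + c ≡ a + c + b
    swap = solve-∀

admissible⇒≤2 : ∀ {N k e} → N ≤ 2 * suc k → Admissible N k e → e ≤ 2
admissible⇒≤2 {N} {k} {e} N≤2q (lo , _) = s≤s⁻¹ (*-cancelʳ-< (suc k) e 3 (begin-strict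
  e * suc k         ≤⟨ lo ⟩
  N + k             <⟨ +-monoʳ-< N (n<1+n k) ⟩
  N + suc k         ≤⟨ +-monoˡ-≤ (suc k) N≤2q ⟩
  2 * suc k + suc k ≡⟨ +-comm (2 * suc k) (suc k) ⟩
  3 * suc k         ∎))
  where open ≤-Reasoning

-- Colouring by consecutive blocks

data SplitView (l : ℕ) {s : ℕ} : Fin (l + s) → Set where
  left  : (a : Fin l) → SplitView l (a ↑ˡ s)
  right : (b : Fin s) → SplitView l (l ↑ʳ b)

splitView : ∀ l {s} (i : Fin (l + s)) → SplitView l i
splitView zero    i       = right i
splitView (suc l) zero    = left zero
splitView (suc l) (suc i) with splitView l i
... | left a  = left (suc a)
... | right b = right b

blockOf : (L : List ℕ) → Fin (sum L) → Fin (length L)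
blockOf (l ∷ L) i = [ (λ _ → zero) , (λ b → suc (blockOf L b)) ]′ (splitAt l i)

blockOf-↑ˡ : ∀ l L (a : Fin l) → blockOf (l ∷ L) (a ↑ˡ sum L) ≡ zero
blockOf-↑ˡ l L a rewrite splitAt-↑ˡ l a (sum L) = refl

blockOf-↑ʳ : ∀ l L (b : Fin (sum L)) → blockOf (l ∷ L) (l ↑ʳ b) ≡ suc (blockOf L b)
blockOf-↑ʳ l L b rewrite splitAt-↑ʳ l (sum L) b = refl

count-blockOf : ∀ L (j : Fin (length L)) → count (λ i → ⌊ blockOf L i ≟ j ⌋) ≡ lookup L j
count-blockOf (l ∷ L) j = begin
    count (λ i → ⌊ blockOf (l ∷ L) i ≟ j ⌋)
  ≡⟨ sum-↑ l _ ⟩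
    count (λ a → ⌊ blockOf (l ∷ L) (a ↑ˡ sum L) ≟ j ⌋) + count (λ b → ⌊ blockOf (l ∷ L) (l ↑ʳ b) ≟ j ⌋)
  ≡⟨ cong₂ _+_ (count-cong (λ a → cong (λ k → ⌊ k ≟ j ⌋) (blockOf-↑ˡ l L a)))
               (count-cong (λ b → cong (λ k → ⌊ k ≟ j ⌋) (blockOf-↑ʳ l L b))) ⟩
    count {l} (λ _ → ⌊ zero ≟ j ⌋) + count (λ b → ⌊ suc (blockOf L b) ≟ j ⌋)
  ≡⟨ by-block j ⟩
    lookup (l ∷ L) j ∎
  where
  open ≡-Reasoning
  by-block : ∀ j → count {l} (λ _ → ⌊ zero ≟ j ⌋) + count (λ b → ⌊ suc (blockOf L b) ≟ j ⌋) ≡ lookup (l ∷ L) j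
  by-block zero    = trans (cong₂ _+_ (count-all l) (count-false (sum L))) (+-identityʳ l)
  by-block (suc j) = trans (cong₂ _+_ (count-false l) (count-cong (λ b → ⌊suc≟suc⌋ (blockOf L b) j)))
                           (count-blockOf L j)

-- The cut at position m may fall strictly inside a block only if that block has at most two elements.
CrossingBlocksSmall : List ℕ → ℕ → Set
CrossingBlocksSmall []      m = ⊤
CrossingBlocksSmall (l ∷ L) m = (0 < m → m < l → l ≤ 2) × CrossingBlocksSmall L (m ∸ l)

squeeze : ∀ {k₁ m k₂} → k₁ < m → m ≤ k₂ → k₂ < 2 → suc k₁ ≡ m × k₂ ≡ m
squeeze (s≤s z≤n) (s≤s z≤n) (s≤s (s≤s z≤n)) = refl , refl

blockOf-crossing : ∀ L {m} (i j : Fin (sum L)) → CrossingBlocksSmall L m →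
  toℕ i < m → m ≤ toℕ j → blockOf L i ≡ blockOf L j → suc (toℕ i) ≡ m × toℕ j ≡ m
blockOf-crossing (l ∷ L) i j (small , _) i<m m≤j same with splitView l i | splitView l j
... | left a | left a′ = squeeze i<m m≤j (≤-trans j<l (small (≤-<-trans z≤n i<m) (≤-<-trans m≤j j<l)))
  where
  j<l : toℕ (a′ ↑ˡ sum L) < l
  j<l = subst (_< l) (sym (toℕ-↑ˡ a′ (sum L))) (toℕ<n a′)
... | left a | right b = ⊥-elim (0≢1+n (trans (sym (blockOf-↑ˡ l L a)) (trans same (blockOf-↑ʳ l L b))))
... | right b | left a = ⊥-elim (0≢1+n (trans (sym (blockOf-↑ˡ l L a)) (trans (sym same) (blockOf-↑ʳ l L b))))
blockOf-crossing (l ∷ L) {m} i j (_ , rest) i<m m≤j same | right b | right b′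
  rewrite toℕ-↑ʳ l b | toℕ-↑ʳ l b′ with m≤n⇒∃[o]m+o≡n (m+n≤o⇒m≤o l (<⇒≤ i<m))
... | m′ , refl with blockOf-crossing L b b′ (subst (CrossingBlocksSmall L) (m+n∸m≡n l m′) rest)
                       (+-cancelˡ-< l _ _ i<m) (+-cancelˡ-≤ l _ _ m≤j)
                       (Fin.suc-injective (trans (sym (blockOf-↑ʳ l L b)) (trans same (blockOf-↑ʳ l L b′))))
... | b+1≡m′ , b′≡m′ = trans (sym (+-suc l (toℕ b))) (cong (l +_) b+1≡m′) , cong (l +_) b′≡m′

crossingBlocksSmall-≤2 : ∀ {L} m → All (_≤ 2) L → CrossingBlocksSmall L m
crossingBlocksSmall-≤2 m []          = tt
crossingBlocksSmall-≤2 m (l≤2 ∷ L≤2) = (λ _ _ → l≤2) , crossingBlocksSmall-≤2 _ L≤2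

crossingBlocksSmall-0 : ∀ L → CrossingBlocksSmall L 0
crossingBlocksSmall-0 []      = tt
crossingBlocksSmall-0 (l ∷ L) = (λ ()) , subst (CrossingBlocksSmall L) (sym (0∸n≡0 l)) (crossingBlocksSmall-0 L)

crossingBlocksSmall-beyond : ∀ L {m} → sum L ≤ m → CrossingBlocksSmall L m
crossingBlocksSmall-beyond []      _       = tt
crossingBlocksSmall-beyond (l ∷ L) {m} L≤m =
  (λ _ m<l → ⊥-elim (<⇒≱ m<l (m+n≤o⇒m≤o l L≤m))) ,
  crossingBlocksSmall-beyond L (m+n≤o⇒m≤o∸n (sum L) (subst (_≤ m) (+-comm l (sum L)) L≤m))

crossingBlocksSmall-++ : ∀ A {B} m → CrossingBlocksSmall A m → CrossingBlocksSmall B (m ∸ sum A) →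
  CrossingBlocksSmall (A ++ B) m
crossingBlocksSmall-++ []      m _            B-ok = B-ok
crossingBlocksSmall-++ (a ∷ A) {B} m (a-ok , A-ok) B-ok =
  a-ok , crossingBlocksSmall-++ A (m ∸ a) A-ok (subst (CrossingBlocksSmall B) (sym (∸-+-assoc m a (sum A))) B-ok)

blockColouring : ∀ m n (L : List ℕ) → m + n ≡ sum L → CrossingBlocksSmall L m →
  All (EqSize (m + n) (length L)) L → EquitableTreeColoring (K m n) (length L) 1
blockColouring m n L N≡ΣL crossing sizes =
  c , equitable , inducesMatchings⇒classForest (K m n) c matching
    , inducesMatchings⇒classDeg≤1 (K m n) c matching
  where
  c : Fin (m + n) → Fin (length L)
  c u = blockOf L (cast N≡ΣL u)

  matching : InducesMatchings (K m n) c
  matching = monochromaticOnlyAtCut⇒inducesMatchings m n c λ u v u<m m≤v same →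
    subst₂ (λ x y → suc x ≡ m × y ≡ m) (toℕ-cast N≡ΣL u) (toℕ-cast N≡ΣL v)
      (blockOf-crossing L (cast N≡ΣL u) (cast N≡ΣL v) crossing
        (subst (_< m) (sym (toℕ-cast N≡ΣL u)) u<m) (subst (m ≤_) (sym (toℕ-cast N≡ΣL v)) m≤v) same)

  classSize≡lookup : ∀ j → classSize (K m n) c j ≡ lookup L j
  classSize≡lookup j = begin
    classSize (K m n) c j                        ≡⟨ length-filterᵇ-tabulate (m + n) id _ ⟩
    count (λ u → ⌊ blockOf L (cast N≡ΣL u) ≟ j ⌋) ≡⟨ count-cast N≡ΣL (λ i → ⌊ blockOf L i ≟ j ⌋) ⟩
    count (λ i → ⌊ blockOf L i ≟ j ⌋)            ≡⟨ count-blockOf L j ⟩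
    lookup L j                                   ∎
    where open ≡-Reasoning

  equitable : ∀ j → EqSize (m + n) (length L) (classSize (K m n) c j)
  equitable j = subst (EqSize (m + n) (length L)) (sym (classSize≡lookup j)) (All.lookup sizes (∈-lookup j))

admissibleBlockColouring : ∀ m n k (L : List ℕ) → length L ≡ suc k → sum L ≡ m + n →
  CrossingBlocksSmall L m → All (Admissible (m + n) k) L → EquitableTreeColoring (K m n) (suc k) 1
admissibleBlockColouring m n k L length≡ sum≡ crossing admissible =
  subst (λ q → EquitableTreeColoring (K m n) q 1) length≡
    (blockColouring m n L (sym sum≡) crossing
      (All.map (subst (λ q → EqSize (m + n) q _) (sym length≡) ∘ admissible⇒eqSize (m + n) k _) admissible))

smallBlocksColouring : ∀ m n k → m + n ≤ 2 * suc k → EquitableTreeColoring (K m n) (suc k) 1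
smallBlocksColouring m n k N≤2q with balancedBlocks (m + n) k
... | L , length≡ , sum≡ , admissible =
  admissibleBlockColouring m n k L length≡ sum≡
    (crossingBlocksSmall-≤2 m (All.map (admissible⇒≤2 N≤2q) admissible)) admissible

admissible-2 : ∀ x p y → Admissible (3 * x + 2 * suc p + 3 * y) (x + p + y) 2
admissible-2 x p y = m+n≤o⇒m≤o (2 * suc (x + p + y)) (≤-reflexive (slack₁ x p y)) ,
                     m+n≤o⇒m≤o (suc (3 * x + 2 * suc p + 3 * y)) (≤-reflexive (slack₂ x p y))
  where
  slack₁ : ∀ x p y → 2 * suc (x + p + y) + (2 * x + p + 2 * y) ≡ 3 * x + 2 * suc p + 3 * y + (x + p + y)
  slack₁ = solve-∀
  slack₂ : ∀ x p y → suc (3 * x + 2 * suc p + 3 * y) + p ≡ 3 * suc (x + p + y)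
  slack₂ = solve-∀

admissible-3 : ∀ x p y → 1 ≤ x + y → Admissible (3 * x + 2 * suc p + 3 * y) (x + p + y) 3
admissible-3 x p y 1≤x+y = s≤s⁻¹ (begin
    suc (3 * suc k)     ≡⟨ +-comm 1 (3 * suc k) ⟩
    3 * suc k + 1       ≤⟨ +-monoʳ-≤ (3 * suc k) 1≤x+y ⟩
    3 * suc k + (x + y) ≡⟨ slack₁ x p y ⟩
    suc (total + k)     ∎) ,
  m+n≤o⇒m≤o (suc total) (≤-reflexive (slack₂ x p y))
  where
  open ≤-Reasoning
  k total : ℕ
  k = x + p + y
  total = 3 * x + 2 * suc p + 3 * y
  slack₁ : ∀ x p y → 3 * suc (x + p + y) + (x + y) ≡ suc (3 * x + 2 * suc p + 3 * y + (x + p + y))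
  slack₁ = solve-∀
  slack₂ : ∀ x p y → suc (3 * x + 2 * suc p + 3 * y) + suc (x + 2 * p + y) ≡ 4 * suc (x + p + y)
  slack₂ = solve-∀

threeTwoThreeColouring : ∀ m n x p y → m + n ≡ 3 * x + 2 * suc p + 3 * y →
  3 * x ≤ m → m ≤ 3 * x + 2 * suc p → EquitableTreeColoring (K m n) (suc (x + p + y)) 1
threeTwoThreeColouring m n x p y N≡ 3x≤m m≤3x+2p =
  admissibleBlockColouring m n (x + p + y) (threes ++ twos ++ threes′) length≡ sum≡ crossing
    (++⁺ (replicate⁺-nonempty x (λ 1≤x → three (≤-trans 1≤x (m≤m+n x y))))
      (++⁺ (replicate⁺ (suc p) two) (replicate⁺-nonempty y (λ 1≤y → three (≤-trans 1≤y (m≤n+m y x))))))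
  where
  two : Admissible (m + n) (x + p + y) 2
  two = subst (λ N → Admissible N (x + p + y) 2) (sym N≡) (admissible-2 x p y)

  three : 1 ≤ x + y → Admissible (m + n) (x + p + y) 3
  three = subst (λ N → Admissible N (x + p + y) 3) (sym N≡) ∘ admissible-3 x p y

  threes twos threes′ : List ℕ
  threes = replicate x 3
  twos = replicate (suc p) 2
  threes′ = replicate y 3

  k : ℕ
  k = x + p + y

  Σthrees : sum threes ≡ 3 * x
  Σthrees = sum-replicate x 3

  Σtwos : sum twos ≡ 2 * suc p
  Σtwos = sum-replicate (suc p) 2

  length≡ : length (threes ++ twos ++ threes′) ≡ suc k
  length≡ = begin
    length (threes ++ twos ++ threes′)                 ≡⟨ length-++ threes ⟩
    length threes + (length (twos ++ threes′))         ≡⟨ cong (length threes +_) (length-++ twos) ⟩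
    length threes + (length twos + length threes′)     ≡⟨ cong₂ _+_ (length-replicate x)
                                                            (cong₂ _+_ (length-replicate (suc p)) (length-replicate y)) ⟩
    x + (suc p + y)                                    ≡⟨ count-blocks x p y ⟩
    suc k                                              ∎
    where
    open ≡-Reasoning
    count-blocks : ∀ x p y → x + (suc p + y) ≡ suc (x + p + y)
    count-blocks = solve-∀

  sum≡ : sum (threes ++ twos ++ threes′) ≡ m + n
  sum≡ = begin
    sum (threes ++ twos ++ threes′)             ≡⟨ sum-++ threes _ ⟩
    sum threes + sum (twos ++ threes′)          ≡⟨ cong (sum threes +_) (sum-++ twos _) ⟩
    sum threes + (sum twos + sum threes′)       ≡⟨ cong₂ _+_ Σthrees (cong₂ _+_ Σtwos (sum-replicate y 3)) ⟩
    3 * x + (2 * suc p + 3 * y)                 ≡⟨ +-assoc (3 * x) _ _ ⟨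
    3 * x + 2 * suc p + 3 * y                   ≡⟨ sym N≡ ⟩
    m + n                                       ∎
    where open ≡-Reasoning

  crossing : CrossingBlocksSmall (threes ++ twos ++ threes′) m
  crossing = crossingBlocksSmall-++ threes m
    (crossingBlocksSmall-beyond threes (subst (_≤ m) (sym Σthrees) 3x≤m))
    (crossingBlocksSmall-++ twos (m ∸ sum threes) (crossingBlocksSmall-≤2 _ (replicate⁺ (suc p) ≤-refl))
      (subst (CrossingBlocksSmall threes′) (sym past-twos) (crossingBlocksSmall-0 threes′)))
    where
    past-twos : m ∸ sum threes ∸ sum twos ≡ 0
    past-twos = trans (∸-+-assoc m (sum threes) (sum twos))
      (m≤n⇒m∸n≡0 (subst (m ≤_) (sym (cong₂ _+_ Σthrees Σtwos)) m≤3x+2p))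

-- The upper bound

-- With q = b + c + 2 + e colours, the sizes are 3 (b + c - 2e times) and 2 (3e + 2 times) when
-- 2e ≤ b + c, and at most 2 otherwise; the blocks of size 3 are split around the cut as
-- b and c - 2e when 2e ≤ c, and as b + c - 2e and 0 when c < 2e.
upper-2e≤c : ∀ b c e → 2 * e ≤ c → EquitableTreeColoring (K (3 * b + 2) (3 * c + 2)) (b + c + 2 + e) 1
upper-2e≤c b c e 2e≤c with m≤n⇒∃[o]m+o≡n 2e≤c
... | y , refl = subst (λ q → EquitableTreeColoring (K (3 * b + 2) (3 * (2 * e + y) + 2)) q 1) (colours b e y)
  (threeTwoThreeColouring (3 * b + 2) (3 * (2 * e + y) + 2) b (3 * e + 1) y (vertices b e y)
    (m≤m+n (3 * b) 2) (m+n≤o⇒m≤o (3 * b + 2) (≤-reflexive (cut b e))))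
  where
  colours : ∀ b e y → suc (b + (3 * e + 1) + y) ≡ b + (2 * e + y) + 2 + e
  colours = solve-∀
  vertices : ∀ b e y → 3 * b + 2 + (3 * (2 * e + y) + 2) ≡ 3 * b + 2 * suc (3 * e + 1) + 3 * y
  vertices = solve-∀
  cut : ∀ b e → 3 * b + 2 + (6 * e + 2) ≡ 3 * b + 2 * suc (3 * e + 1)
  cut = solve-∀

upper-c<2e≤b+c : ∀ b c e → c < 2 * e → 2 * e ≤ b + c →
  EquitableTreeColoring (K (3 * b + 2) (3 * c + 2)) (b + c + 2 + e) 1
upper-c<2e≤b+c b c e c<2e 2e≤b+c with m≤n⇒∃[o]m+o≡n 2e≤b+c
... | x , 2e+x≡b+c = subst (λ q → EquitableTreeColoring (K (3 * b + 2) (3 * c + 2)) q 1) colours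
  (threeTwoThreeColouring (3 * b + 2) (3 * c + 2) x (3 * e + 1) 0 vertices
    (≤-trans (*-monoʳ-≤ 3 (<⇒≤ x<b)) (m≤m+n (3 * b) 2))
    (≤-trans (m≤m+n (3 * b + 2) (3 * c + 2)) (≤-reflexive (trans vertices (+-identityʳ _)))))
  where
  x<b : x < b
  x<b = +-cancelˡ-< (2 * e) x b (begin-strict
    2 * e + x ≡⟨ 2e+x≡b+c ⟩
    b + c     <⟨ +-monoʳ-< b c<2e ⟩
    b + 2 * e ≡⟨ +-comm b (2 * e) ⟩
    2 * e + b ∎)
    where open ≤-Reasoning

  colours : suc (x + (3 * e + 1) + 0) ≡ b + c + 2 + e
  colours = trans (regroup x e) (cong (λ s → s + 2 + e) 2e+x≡b+c)
    where
    regroup : ∀ x e → suc (x + (3 * e + 1) + 0) ≡ 2 * e + x + 2 + e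
    regroup = solve-∀

  vertices : 3 * b + 2 + (3 * c + 2) ≡ 3 * x + 2 * suc (3 * e + 1) + 3 * 0
  vertices = begin
    3 * b + 2 + (3 * c + 2)             ≡⟨ by-sum b c ⟩
    3 * (b + c) + 4                      ≡⟨ cong (λ s → 3 * s + 4) 2e+x≡b+c ⟨
    3 * (2 * e + x) + 4                  ≡⟨ by-parts e x ⟩
    3 * x + 2 * suc (3 * e + 1) + 3 * 0  ∎
    where
    open ≡-Reasoning
    by-sum : ∀ b c → 3 * b + 2 + (3 * c + 2) ≡ 3 * (b + c) + 4
    by-sum = solve-∀
    by-parts : ∀ e x → 3 * (2 * e + x) + 4 ≡ 3 * x + 2 * suc (3 * e + 1) + 3 * 0
    by-parts = solve-∀

upper-b+c<2e : ∀ b c e → b + c < 2 * e → EquitableTreeColoring (K (3 * b + 2) (3 * c + 2)) (b + c + 2 + e) 1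
upper-b+c<2e b c e b+c<2e = subst (λ q → EquitableTreeColoring (K (3 * b + 2) (3 * c + 2)) q 1) (colours b c e)
  (smallBlocksColouring (3 * b + 2) (3 * c + 2) (b + c + 1 + e) (begin
    3 * b + 2 + (3 * c + 2)           ≡⟨ split b c ⟩
    2 * (b + c + 2) + (b + c)         ≤⟨ +-monoʳ-≤ (2 * (b + c + 2)) (<⇒≤ b+c<2e) ⟩
    2 * (b + c + 2) + 2 * e           ≡⟨ merge b c e ⟩
    2 * suc (b + c + 1 + e)           ∎))
  where
  open ≤-Reasoning
  colours : ∀ b c e → suc (b + c + 1 + e) ≡ b + c + 2 + e
  colours = solve-∀
  split : ∀ b c → 3 * b + 2 + (3 * c + 2) ≡ 2 * (b + c + 2) + (b + c)
  split = solve-∀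
  merge : ∀ b c e → 2 * (b + c + 2) + 2 * e ≡ 2 * suc (b + c + 1 + e)
  merge = solve-∀

upperBound : ∀ b c q → b + c + 2 ≤ q → EquitableTreeColoring (K (3 * b + 2) (3 * c + 2)) q 1
upperBound b c q b+c+2≤q with m≤n⇒∃[o]m+o≡n b+c+2≤q
... | e , refl with 2 * e ≤? c | 2 * e ≤? b + c
... | yes 2e≤c | _          = upper-2e≤c b c e 2e≤c
... | no 2e≰c  | yes 2e≤b+c = upper-c<2e≤b+c b c e (≰⇒> 2e≰c) 2e≤b+c
... | no _     | no 2e≰b+c  = upper-b+c<2e b c e (≰⇒> 2e≰b+c)

-- The lower bound

-- A class of size 3 or 4 is not an edge, so it lies inside one side: its part in A has
-- size 0, 3 or 4, the last only when the class has size 4.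
residue-bound : ∀ f g → f + g ≡ 3 ⊎ f + g ≡ 4 → (1 ≤ f → g ≤ 1) → (1 ≤ g → f ≤ 1) →
  f % 3 + 3 ≤ f + g
residue-bound 0 g size _ _ = [ ≤-reflexive ∘ sym , (λ g≡4 → subst (3 ≤_) (sym g≡4) (n≤1+n 3)) ]′ size
residue-bound 1 zero (inj₁ ()) _ _
residue-bound 1 zero (inj₂ ()) _ _
residue-bound 1 (suc zero) (inj₁ ()) _ _
residue-bound 1 (suc zero) (inj₂ ()) _ _
residue-bound 1 (suc (suc g)) _ g≤1 _ with g≤1 (s≤s z≤n)
... | s≤s ()
residue-bound 2 zero (inj₁ ()) _ _
residue-bound 2 zero (inj₂ ()) _ _
residue-bound 2 (suc g) _ _ f≤1 with f≤1 (s≤s z≤n)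
... | s≤s ()
residue-bound 3 g _ _ _ = m≤m+n 3 g
residue-bound 4 g _ _ _ = m≤m+n 4 g
residue-bound (suc (suc (suc (suc (suc f))))) g (inj₁ ()) _ _
residue-bound (suc (suc (suc (suc (suc f))))) g (inj₂ ()) _ _

equitable-K-3q+1⇒m%3≤1 : ∀ m n k → 1 ≤ k → m + n ≡ 3 * suc k + 1 →
  EquitableTreeColoring (K m n) (suc k) 1 → m % 3 ≤ 1
equitable-K-3q+1⇒m%3≤1 m n k 1≤k N≡ (c , sizes , _ , degree) = begin
  m % 3           ≡⟨ cong (_% 3) m≡R+X*3 ⟩
  (R + X * 3) % 3 ≡⟨ [m+kn]%n≡m%n R X 3 ⟩
  R % 3           ≡⟨ m<n⇒m%n≡m (s≤s (≤-trans R≤1 (n≤1+n 1))) ⟩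
  R               ≤⟨ R≤1 ⟩
  1               ∎
  where
  open ≤-Reasoning
  q : ℕ
  q = suc k

  inA inB : Fin q → ℕ
  inA i = count (λ a → ⌊ c (a ↑ˡ n) ≟ i ⌋)
  inB i = count (λ b → ⌊ c (m ↑ʳ b) ≟ i ⌋)

  R X : ℕ
  R = ∑[ i < q ] (inA i % 3)
  X = ∑[ i < q ] (inA i / 3)

  three-or-four : ∀ i → inA i + inB i ≡ 3 ⊎ inA i + inB i ≡ 4
  three-or-four i = subst (λ s → s ≡ 3 ⊎ s ≡ 4) (classSize-K m n c i) (eqSize-3q+1 1≤k N≡ (sizes i))

  ΣinA : ∑[ i < q ] inA i ≡ m
  ΣinA = sum-count-fibres (λ a → c (a ↑ˡ n))

  ΣinB : ∑[ i < q ] inB i ≡ n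
  ΣinB = sum-count-fibres (λ b → c (m ↑ʳ b))

  R≤1 : R ≤ 1
  R≤1 = +-cancelʳ-≤ (q * 3) R 1 (begin
    R + q * 3                           ≡⟨ cong (R +_) (sum-const q 3) ⟨
    R + ∑[ i < q ] 3                    ≡⟨ ∑-distrib-+ (λ i → inA i % 3) (λ _ → 3) ⟨
    ∑[ i < q ] (inA i % 3 + 3)          ≤⟨ sum-mono-≤ (λ i → residue-bound (inA i) (inB i) (three-or-four i)
                                              (classDeg≤1⇒one-sidedˡ m n c degree i)
                                              (classDeg≤1⇒one-sidedʳ m n c degree i)) ⟩
    ∑[ i < q ] (inA i + inB i)          ≡⟨ ∑-distrib-+ inA inB ⟩
    ∑[ i < q ] inA i + ∑[ i < q ] inB i ≡⟨ cong₂ _+_ ΣinA ΣinB ⟩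
    m + n                               ≡⟨ N≡ ⟩
    3 * q + 1                           ≡⟨ +-comm (3 * q) 1 ⟩
    1 + 3 * q                           ≡⟨ cong (1 +_) (*-comm 3 q) ⟩
    1 + q * 3                           ∎)

  m≡R+X*3 : m ≡ R + X * 3
  m≡R+X*3 = begin-equality
    m                                      ≡⟨ ΣinA ⟨
    ∑[ i < q ] inA i                       ≡⟨ sum-cong-≗ (λ i → m≡m%n+[m/n]*n (inA i) 3) ⟩
    ∑[ i < q ] (inA i % 3 + inA i / 3 * 3) ≡⟨ ∑-distrib-+ (λ i → inA i % 3) (λ i → inA i / 3 * 3) ⟩
    R + ∑[ i < q ] (inA i / 3 * 3)         ≡⟨ cong (R +_) (*-distribʳ-sum 3 (λ i → inA i / 3)) ⟨
    R + X * 3                              ∎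

lowerBound : ∀ b c → 1 ≤ b + c → ¬ EquitableTreeColoring (K (3 * b + 2) (3 * c + 2)) (suc (b + c)) 1
lowerBound b c 1≤b+c colouring = <⇒≱ (s≤s (s≤s z≤n)) (begin
  2               ≡⟨ [m+kn]%n≡m%n 2 b 3 ⟨
  (2 + b * 3) % 3 ≡⟨ cong (_% 3) (+-comm 2 (b * 3)) ⟩
  (b * 3 + 2) % 3 ≡⟨ cong (λ x → (x + 2) % 3) (*-comm b 3) ⟩
  (3 * b + 2) % 3 ≤⟨ equitable-K-3q+1⇒m%3≤1 (3 * b + 2) (3 * c + 2) (b + c) 1≤b+c (vertices b c) colouring ⟩
  1               ∎)
  where
  open ≤-Reasoning
  vertices : ∀ b c → 3 * b + 2 + (3 * c + 2) ≡ 3 * suc (b + c) + 1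
  vertices = solve-∀

lemma12 : (b c : ℕ) → 1 Data.Nat.≤ b → 1 Data.Nat.≤ c →
    IsStrongEqVertexArboricity (K (3 * b + 2) (3 * c + 2)) 1 (b + c + 2)
lemma12 b c 1≤b _ = upperBound b c , minimal
  where
  minimal : ∀ p → StronglyColorableFrom (K (3 * b + 2) (3 * c + 2)) 1 p → b + c + 2 ≤ p
  minimal p colourable with p ≤? suc (b + c)
  ... | yes p≤b+c+1 = ⊥-elim (lowerBound b c (≤-trans 1≤b (m≤m+n b c)) (colourable (suc (b + c)) p≤b+c+1))
  ... | no  p≰b+c+1 = subst (_≤ p) (sym (+-comm (b + c) 2)) (≰⇒> p≰b+c+1)
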